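{- None of the logics $\mathbf{il}^-(\mathbf{I2})$, $\mathbf{il}^-(\mathbf{J1}^u,\mathbf{I2})$, $\mathbf{il}^-(\mathbf{J15}^u,\mathbf{I2})$ has the Craig interpolation property for $\mathcal{L}(\Box,\mathbf{I})$-formulas; that is, for each such logic $\ell$ there exist $\mathcal{L}(\Box,\mathbf{I})$-formulas $A,B$ with $\ell\vdash A\to B$ such that there is no $\mathcal{L}(\Box,\mathbf{I})$-formula $C$ with $\mathrm{var}(C)\subseteq\mathrm{var}(A)\cap\mathrm{var}(B)$, $\ell\vdash A\to C$ and $\ell\vdash C\to B$.
   Context: $\mathcal{L}(\Box,\mathbf{I})$-formulas are built from propositional variables and $\bot$ by $\to$ and unary modal operators $\Box$, $\mathbf{I}$; $\Diamond A:\equiv\neg\Box\neg A$. $\mathrm{var}(A)$ is the set of propositional variables occurring in $A$. The logic $\mathbf{il}^-$ has as axioms all tautologies, $\Box(A\to B)\to(\Box A\to\Box B)$, $\Box(\Box A\to A)\to\Box A$, $\Box\bot\leftrightarrow\mathbf{I}\bot$; rules Modus Ponens, Necessitation, and from $A\to B$ infer $\mathbf{I}A\to\mathbf{I}B$. $\mathbf{il}^-(\Sigma_1,\dots,\Sigma_k)$ is obtained by adding the axiom schemata $\Sigma_i$, where $\mathbf{I2}$: $\Box(A\to B)\to(\mathbf{I}A\to\mathbf{I}B)$; $\mathbf{J1}^u$: $\Box A\to\mathbf{I}A$; $\mathbf{J15}^u$: $\Box(A\lor\Diamond A)\to\mathbf{I}A$. -}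

module Defs where

open import Data.Nat using (ℕ)
open import Data.Bool using (Bool; true; false; _∧_; _∨_; not)
open import Data.Product using (Σ; _×_; _,_)
open import Data.Empty using (⊥)
open import Relation.Binary.PropositionalEquality using (_≡_)
open import Relation.Nullary using (¬_)

data Fm : Set where
  var  : ℕ → Fm
  bot  : Fm
  _⇒_  : Fm → Fm → Fm
  □_   : Fm → Fm
  I_   : Fm → Fm

infixr 5 _⇒_
infix 7 □_ I_
infixr 4 _∨f_
infixr 4 _∧f_
infix 3 _⇔_
infix 7 ◇_ ¬f_

¬f_ : Fm → Fm
¬f A = A ⇒ bot

_∨f_ : Fm → Fm → Fm
A ∨f B = (¬f A) ⇒ B

_∧f_ : Fm → Fm → Fm
A ∧f B = ¬f (A ⇒ ¬f B)

_⇔_ : Fm → Fm → Fm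
A ⇔ B = (A ⇒ B) ∧f (B ⇒ A)

◇_ : Fm → Fm
◇ A = ¬f (□ (¬f A))

-- Classical truth-value of a formula, treating variables and modalized
-- formulas (□A, IA) as propositional atoms, valued by v.
eval : (Fm → Bool) → Fm → Bool
eval v (var p) = v (var p)
eval v bot = false
eval v (A ⇒ B) = not (eval v A) ∨ eval v B
eval v (□ A) = v (□ A)
eval v (I A) = v (I A)

Tautology : Fm → Set
Tautology A = ∀ (v : Fm → Bool) → eval v A ≡ true

data Occurs (p : ℕ) : Fm → Set where
  here : Occurs p (var p)
  impl : ∀ {A B} → Occurs p A → Occurs p (A ⇒ B)
  impr : ∀ {A B} → Occurs p B → Occurs p (A ⇒ B)
  box  : ∀ {A} → Occurs p A → Occurs p (□ A)
  iop  : ∀ {A} → Occurs p A → Occurs p (I A)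

Schema : Set₁
Schema = Fm → Set

data I2 : Schema where
  ax : ∀ A B → I2 (□ (A ⇒ B) ⇒ (I A ⇒ I B))

data J1u : Schema where
  ax : ∀ A → J1u (□ A ⇒ I A)

data J15u : Schema where
  ax : ∀ A → J15u (□ (A ∨f ◇ A) ⇒ I A)

_∪_ : Schema → Schema → Schema
(S ∪ T) A = Σ Bool λ { true → S A ; false → T A }

data _⊢_ (S : Schema) : Fm → Set where
  taut  : ∀ {A} → Tautology A → S ⊢ A
  axK   : ∀ A B → S ⊢ (□ (A ⇒ B) ⇒ (□ A ⇒ □ B))
  axL   : ∀ A → S ⊢ (□ (□ A ⇒ A) ⇒ □ A)
  axBI  : S ⊢ (□ bot ⇔ I bot)
  extra : ∀ {A} → S A → S ⊢ A
  mp    : ∀ {A B} → S ⊢ (A ⇒ B) → S ⊢ A → S ⊢ B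
  nec   : ∀ {A} → S ⊢ A → S ⊢ (□ A)
  rI    : ∀ {A B} → S ⊢ (A ⇒ B) → S ⊢ (I A ⇒ I B)

infix 3 _⊢_

Interpolant : Schema → Fm → Fm → Fm → Set
Interpolant S A B C = (∀ p → Occurs p C → Occurs p A × Occurs p B)
                    × (S ⊢ (A ⇒ C)) × (S ⊢ (C ⇒ B))

NoCIP : Schema → Set
NoCIP S = Σ Fm λ A → Σ Fm λ B →
  (S ⊢ (A ⇒ B)) × ¬ (Σ Fm λ C → Interpolant S A B C)

il-I2 : Schema
il-I2 = I2

il-J1u-I2 : Schema
il-J1u-I2 = J1u ∪ I2

il-J15u-I2 : Schema
il-J15u-I2 = J15u ∪ I2

-- The formula Fix x = x ↔ ¬Ix pins x down: by I2, □(x ↔ y) gives Ix ↔ Iy, so two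
-- solutions of the equation agree wherever □ says they agree, and Löb's axiom removes
-- this assumption.  Hence ⊡Fix p ∧ p → (⊡Fix q → q) is provable, while any interpolant
-- would be variable-free.  On the frame (ℕ, >), with I read so that all three logics are
-- sound, a variable-free formula is eventually constant, whereas making p and q true
-- exactly at the odd points satisfies ⊡Fix p and ⊡Fix q everywhere and forces the
-- interpolant to be true exactly at the odd points.
module Submission where

open import Defs
open import Data.Bool using (Bool; true; false; _∧_; _∨_; not; T)
open import Data.Bool.Properties
  using (∧-assoc; ∧-idem; ∨-zeroʳ; ∧-conicalˡ; ∧-conicalʳ; not-¬; T-≡; T-∧; ⇔→≡)
open import Data.Empty using (⊥-elim)
open import Data.Fin using (Fin; #_)
open import Data.Nat using (ℕ; zero; suc; _≤_; s≤s; _⊔_)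
open import Data.Nat.Properties using (≤-refl; ≤-trans; m≤m⊔n; m≤n⊔m; 0≢1+n)
open import Data.Product using (Σ; _×_; _,_; proj₁; proj₂)
open import Data.Vec using (Vec; []; _∷_; lookup; map)
open import Data.Vec.Properties using (lookup-map)
open import Function using (_∘_)
open import Function.Bundles using (Equivalence; mk⇔)
open import Relation.Binary.PropositionalEquality
  using (_≡_; _≗_; refl; sym; trans; cong; cong₂; module ≡-Reasoning)
open import Relation.Nullary using (¬_)
open import Relation.Unary using (_⊆_)

private variable
  n k : ℕ
  S S′ : Schema
  A B C D x y : Fm

data PropFm (n : ℕ) : Set where
  atom : Fin n → PropFm n
  bot  : PropFm n
  _⇒_  : PropFm n → PropFm n → PropFm n

infixr 5 _⇒_
infixr 4 _∧ₚ_
infix 3 _⇔ₚ_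

¬ₚ : PropFm n → PropFm n
¬ₚ φ = φ ⇒ bot

_∧ₚ_ : PropFm n → PropFm n → PropFm n
φ ∧ₚ ψ = ¬ₚ (φ ⇒ ¬ₚ ψ)

_⇔ₚ_ : PropFm n → PropFm n → PropFm n
φ ⇔ₚ ψ = (φ ⇒ ψ) ∧ₚ (ψ ⇒ φ)

⟦_⟧ : PropFm n → Vec Bool n → Bool
⟦ atom i ⟧ ρ = lookup ρ i
⟦ bot ⟧ ρ = false
⟦ φ ⇒ ψ ⟧ ρ = not (⟦ φ ⟧ ρ) ∨ ⟦ ψ ⟧ ρ

_⟨_⟩ : PropFm n → Vec Fm n → Fm
atom i ⟨ σ ⟩ = lookup σ i
bot ⟨ σ ⟩ = bot
(φ ⇒ ψ) ⟨ σ ⟩ = φ ⟨ σ ⟩ ⇒ ψ ⟨ σ ⟩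

eval-⟨⟩ : ∀ v (φ : PropFm n) σ → eval v (φ ⟨ σ ⟩) ≡ ⟦ φ ⟧ (map (eval v) σ)
eval-⟨⟩ v (atom i) σ = sym (lookup-map i (eval v) σ)
eval-⟨⟩ v bot σ = refl
eval-⟨⟩ v (φ ⇒ ψ) σ = cong₂ (λ a b → not a ∨ b) (eval-⟨⟩ v φ σ) (eval-⟨⟩ v ψ σ)

allAssignments : ∀ n → (Vec Bool n → Bool) → Bool
allAssignments zero g = g []
allAssignments (suc n) g =
  allAssignments n (g ∘ (true ∷_)) ∧ allAssignments n (g ∘ (false ∷_))

allAssignments-sound : ∀ (g : Vec Bool n → Bool) → T (allAssignments n g) → ∀ ρ → T (g ρ)
allAssignments-sound {zero} g holds [] = holds
allAssignments-sound {suc n} g holds (true ∷ ρ) =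
  allAssignments-sound (g ∘ (true ∷_)) (proj₁ (Equivalence.to T-∧ holds)) ρ
allAssignments-sound {suc n} g holds (false ∷ ρ) =
  allAssignments-sound (g ∘ (false ∷_)) (proj₂ (Equivalence.to T-∧ holds)) ρ

-- The check is an implicit argument of type T b, which Agda fills in by η once b computes to true.
instance-taut : (φ : PropFm n) {_ : T (allAssignments n ⟦ φ ⟧)} (σ : Vec Fm n) →
                Tautology (φ ⟨ σ ⟩)
instance-taut φ {valid} σ v = begin
  eval v (φ ⟨ σ ⟩)          ≡⟨ eval-⟨⟩ v φ σ ⟩
  ⟦ φ ⟧ (map (eval v) σ)    ≡⟨ Equivalence.to T-≡ (allAssignments-sound ⟦ φ ⟧ valid _) ⟩
  true                      ∎
  where open ≡-Reasoning

mp₂ : S ⊢ A ⇒ B ⇒ C → S ⊢ A → S ⊢ B → S ⊢ C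
mp₂ d e f = mp (mp d e) f

⇒-trans : S ⊢ A ⇒ B → S ⊢ B ⇒ C → S ⊢ A ⇒ C
⇒-trans {A = A} {B} {C} = mp₂ (taut (instance-taut syllogism (A ∷ B ∷ C ∷ [])))
  where
  syllogism : PropFm 3
  syllogism = let a = atom (# 0); b = atom (# 1); c = atom (# 2) in
    (a ⇒ b) ⇒ (b ⇒ c) ⇒ a ⇒ c

⇒-trans₂ : S ⊢ A ⇒ B ⇒ C → S ⊢ C ⇒ D → S ⊢ A ⇒ B ⇒ D
⇒-trans₂ {A = A} {B} {C} {D} = mp₂ (taut (instance-taut syllogism₂ (A ∷ B ∷ C ∷ D ∷ [])))
  where
  syllogism₂ : PropFm 4
  syllogism₂ = let a = atom (# 0); b = atom (# 1); c = atom (# 2); d = atom (# 3) in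
    (a ⇒ b ⇒ c) ⇒ (c ⇒ d) ⇒ a ⇒ b ⇒ d

□-mono : S ⊢ A ⇒ B → S ⊢ □ A ⇒ □ B
□-mono {A = A} {B} d = mp (axK A B) (nec d)

□-mono₂ : S ⊢ A ⇒ B ⇒ C → S ⊢ □ A ⇒ □ B ⇒ □ C
□-mono₂ {B = B} {C} d = ⇒-trans (□-mono d) (axK B C)

I-mono-□ : I2 ⊆ S → S ⊢ C ⇒ A ⇒ B → S ⊢ □ C ⇒ I A ⇒ I B
I-mono-□ {A = A} {B} i2 d = ⇒-trans (□-mono d) (extra (i2 (ax A B)))

Fix : Fm → Fm
Fix x = x ⇔ ¬f I x

⊡_ : Fm → Fm
⊡ A = A ∧f □ A

infix 7 ⊡_

Fix-unique-under-□ : I2 ⊆ S → ∀ x y → S ⊢ Fix x ⇒ Fix y ⇒ □ (x ⇔ y) ⇒ (x ⇔ y)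
Fix-unique-under-□ i2 x y =
  mp₂ (taut (instance-taut fixedPointsAgree (x ∷ y ∷ □ (x ⇔ y) ∷ I x ∷ I y ∷ [])))
      (I-mono-□ i2 (taut (instance-taut ⇔-elimˡ (x ∷ y ∷ []))))
      (I-mono-□ i2 (taut (instance-taut ⇔-elimʳ (x ∷ y ∷ []))))
  where
  ⇔-elimˡ ⇔-elimʳ : PropFm 2
  ⇔-elimˡ = let a = atom (# 0); b = atom (# 1) in (a ⇔ₚ b) ⇒ a ⇒ b
  ⇔-elimʳ = let a = atom (# 0); b = atom (# 1) in (a ⇔ₚ b) ⇒ b ⇒ a
  fixedPointsAgree : PropFm 5
  fixedPointsAgree =
    let a = atom (# 0); b = atom (# 1); c = atom (# 2); ia = atom (# 3); ib = atom (# 4) in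
    (c ⇒ ia ⇒ ib) ⇒ (c ⇒ ib ⇒ ia) ⇒ (a ⇔ₚ ¬ₚ ia) ⇒ (b ⇔ₚ ¬ₚ ib) ⇒ c ⇒ (a ⇔ₚ b)

Fix-unique : I2 ⊆ S → ∀ x y → S ⊢ (⊡ Fix x ∧f x) ⇒ (⊡ Fix y ⇒ y)
Fix-unique {S} i2 x y =
  mp₂ (taut (instance-taut combine (Fix x ∷ Fix y ∷ □ (x ⇔ y) ∷ □ Fix x ∷ □ Fix y ∷ x ∷ y ∷ [])))
      now everywhere
  where
  now : S ⊢ Fix x ⇒ Fix y ⇒ □ (x ⇔ y) ⇒ (x ⇔ y)
  now = Fix-unique-under-□ i2 x y
  everywhere : S ⊢ □ Fix x ⇒ □ Fix y ⇒ □ (x ⇔ y)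
  everywhere = ⇒-trans₂ (□-mono₂ now) (axL (x ⇔ y))
  combine : PropFm 7
  combine =
    let f = atom (# 0); g = atom (# 1); c = atom (# 2); □f = atom (# 3); □g = atom (# 4)
        a = atom (# 5); b = atom (# 6) in
    (f ⇒ g ⇒ c ⇒ (a ⇔ₚ b)) ⇒ (□f ⇒ □g ⇒ c) ⇒ ((f ∧ₚ □f) ∧ₚ a) ⇒ ((g ∧ₚ □g) ⇒ b)

allBelow : (ℕ → Bool) → ℕ → Bool
allBelow f zero = true
allBelow f (suc n) = f n ∧ allBelow f n

Valuation : Set
Valuation = ℕ → ℕ → Bool

-- I A holds at 0 and, at n + 1, iff A holds at 0 or at n: so I⊥ ↔ □⊥, and □(A → B) at
-- n + 1 covers both points that I inspects.
sat : Valuation → Fm → ℕ → Bool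
sat V (var p) n = V p n
sat V bot n = false
sat V (A ⇒ B) n = not (sat V A n) ∨ sat V B n
sat V (□ A) n = allBelow (sat V A) n
sat V (I A) zero = true
sat V (I A) (suc n) = sat V A 0 ∨ sat V A n

Valid : Fm → Set
Valid A = ∀ V n → sat V A n ≡ true

eval-sat : ∀ V n A → eval (λ F → sat V F n) A ≡ sat V A n
eval-sat V n (var p) = refl
eval-sat V n bot = refl
eval-sat V n (A ⇒ B) = cong₂ (λ a b → not a ∨ b) (eval-sat V n A) (eval-sat V n B)
eval-sat V n (□ A) = refl
eval-sat V n (I A) = refl

⇒ᵇ-intro : ∀ {a b} → (a ≡ true → b ≡ true) → not a ∨ b ≡ true
⇒ᵇ-intro {true} h = h refl
⇒ᵇ-intro {false} h = refl

⇒ᵇ-elim : ∀ {a b} → not a ∨ b ≡ true → a ≡ true → b ≡ true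
⇒ᵇ-elim {true} h refl = h

∨-mono : ∀ {a b c d} → (a ≡ true → c ≡ true) → (b ≡ true → d ≡ true) →
         a ∨ b ≡ true → c ∨ d ≡ true
∨-mono {true} f g h rewrite f refl = refl
∨-mono {false} {true} {c} f g h rewrite g refl = ∨-zeroʳ c

∧-intro : ∀ {a b} → a ≡ true → b ≡ true → a ∧ b ≡ true
∧-intro refl refl = refl

∨-introˡ : ∀ {a b} → a ≡ true → a ∨ b ≡ true
∨-introˡ refl = refl

allBelow-K : ∀ f g n → allBelow (λ m → not (f m) ∨ g m) n ≡ true → allBelow f n ≡ true →
             allBelow g n ≡ true
allBelow-K f g zero _ _ = refl
allBelow-K f g (suc n) fg f′ =
  ∧-intro (⇒ᵇ-elim (∧-conicalˡ (not (f n) ∨ g n) _ fg) (∧-conicalˡ (f n) _ f′))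
          (allBelow-K f g n (∧-conicalʳ (not (f n) ∨ g n) _ fg) (∧-conicalʳ (f n) _ f′))

allBelow-löb : ∀ f n → allBelow (λ m → not (allBelow f m) ∨ f m) n ≡ true → allBelow f n ≡ true
allBelow-löb f zero _ = refl
allBelow-löb f (suc n) h = ∧-intro (⇒ᵇ-elim (∧-conicalˡ _ _ h) below) below
  where
  below : allBelow f n ≡ true
  below = allBelow-löb f n (∧-conicalʳ _ _ h)

allBelow-all : ∀ f n → (∀ m → f m ≡ true) → allBelow f n ≡ true
allBelow-all f zero h = refl
allBelow-all f (suc n) h = ∧-intro (h n) (allBelow-all f n h)

allBelow-zero : ∀ f n → allBelow f (suc n) ≡ true → f 0 ≡ true
allBelow-zero f zero h = ∧-conicalˡ _ _ h
allBelow-zero f (suc n) h = allBelow-zero f n (∧-conicalʳ (f (suc n)) _ h)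

I-mono-sat : ∀ V A B n → (sat V A 0 ≡ true → sat V B 0 ≡ true) →
             (sat V A n ≡ true → sat V B n ≡ true) → sat V (I A ⇒ I B) (suc n) ≡ true
I-mono-sat V A B n at0 atn =
  ⇒ᵇ-intro {sat V (I A) (suc n)} (∨-mono {sat V A 0} {sat V A n} at0 atn)

soundness : S ⊆ Valid → (S ⊢_) ⊆ Valid
soundness valid (taut {A} t) V n = trans (sym (eval-sat V n A)) (t _)
soundness valid (axK A B) V n = ⇒ᵇ-intro λ h → ⇒ᵇ-intro (allBelow-K (sat V A) (sat V B) n h)
soundness valid (axL A) V n = ⇒ᵇ-intro (allBelow-löb (sat V A) n)
soundness valid axBI V zero = refl
soundness valid axBI V (suc n) = refl
soundness valid (extra s) V n = valid s V n
soundness valid (mp d e) V n = ⇒ᵇ-elim (soundness valid d V n) (soundness valid e V n)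
soundness valid (nec d) V n = allBelow-all _ n (λ m → soundness valid d V m)
soundness valid (rI d) V zero = refl
soundness valid (rI {A} {B} d) V (suc n) =
  I-mono-sat V A B n (⇒ᵇ-elim (soundness valid d V 0)) (⇒ᵇ-elim (soundness valid d V n))

I2-valid : I2 ⊆ Valid
I2-valid (ax A B) V zero = refl
I2-valid (ax A B) V (suc n) = ⇒ᵇ-intro λ h →
  I-mono-sat V A B n (⇒ᵇ-elim (allBelow-zero (sat V (A ⇒ B)) n h))
                     (⇒ᵇ-elim (∧-conicalˡ (sat V (A ⇒ B) n) _ h))

J1u-valid : J1u ⊆ Valid
J1u-valid (ax A) V zero = refl
J1u-valid (ax A) V (suc n) = ⇒ᵇ-intro λ h → ∨-introˡ (allBelow-zero (sat V A) n h)

-- ◇A is false at the point 0, so A ∨ ◇A holding at 0 means A holds there.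
J15u-valid : J15u ⊆ Valid
J15u-valid (ax A) V zero = refl
J15u-valid (ax A) V (suc n) = ⇒ᵇ-intro λ h →
  ∨-introˡ (∨◇-at-zero (sat V A 0) (allBelow-zero (sat V (A ∨f ◇ A)) n h))
  where
  ∨◇-at-zero : ∀ a → not (not a ∨ false) ∨ false ≡ true → a ≡ true
  ∨◇-at-zero true _ = refl

∪-⊆ : S ⊆ Valid → S′ ⊆ Valid → (S ∪ S′) ⊆ Valid
∪-⊆ S-valid S′-valid (true , s) = S-valid s
∪-⊆ S-valid S′-valid (false , s′) = S′-valid s′

Closed : Fm → Set
Closed C = ∀ p → ¬ Occurs p C

StableFrom : ℕ → (ℕ → Bool) → Set
StableFrom N f = ∀ {m} → N ≤ m → f (suc m) ≡ f m

allBelow-stable : ∀ f N → StableFrom N f → StableFrom (suc N) (allBelow f)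
allBelow-stable f N stable {suc m} (s≤s N≤m) = begin
  f (suc m) ∧ (f m ∧ allBelow f m)   ≡⟨ cong (_∧ (f m ∧ allBelow f m)) (stable N≤m) ⟩
  f m ∧ (f m ∧ allBelow f m)         ≡⟨ sym (∧-assoc (f m) (f m) _) ⟩
  (f m ∧ f m) ∧ allBelow f m         ≡⟨ cong (_∧ allBelow f m) (∧-idem (f m)) ⟩
  f m ∧ allBelow f m                 ∎
  where open ≡-Reasoning

closed-eventually-stable : ∀ V C → Closed C → Σ ℕ λ N → StableFrom N (sat V C)
closed-eventually-stable V (var p) closed = ⊥-elim (closed p here)
closed-eventually-stable V bot closed = 0 , λ _ → refl
closed-eventually-stable V (A ⇒ B) closed
  with closed-eventually-stable V A (λ p → closed p ∘ impl)
     | closed-eventually-stable V B (λ p → closed p ∘ impr)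
... | NA , stableA | NB , stableB = NA ⊔ NB , λ N≤m →
  cong₂ (λ a b → not a ∨ b) (stableA (≤-trans (m≤m⊔n NA NB) N≤m))
                            (stableB (≤-trans (m≤n⊔m NA NB) N≤m))
closed-eventually-stable V (□ A) closed
  with closed-eventually-stable V A (λ p → closed p ∘ box)
... | N , stable = suc N , allBelow-stable (sat V A) N stable
closed-eventually-stable V (I A) closed
  with closed-eventually-stable V A (λ p → closed p ∘ iop)
... | N , stable = suc N , λ { {suc m} (s≤s N≤m) → cong (sat V A 0 ∨_) (stable N≤m) }

data Over (k : ℕ) : Fm → Set where
  var : Over k (var k)
  bot : Over k bot
  _⇒_ : Over k A → Over k B → Over k (A ⇒ B)
  □_  : Over k A → Over k (□ A)
  I_  : Over k A → Over k (I A)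

over-occurs : ∀ {p} → Over k A → Occurs p A → p ≡ k
over-occurs var here = refl
over-occurs (a ⇒ b) (impl o) = over-occurs a o
over-occurs (a ⇒ b) (impr o) = over-occurs b o
over-occurs (□ a) (box o) = over-occurs a o
over-occurs (I a) (iop o) = over-occurs a o

over-¬ : Over k A → Over k (¬f A)
over-¬ a = a ⇒ bot

over-∧ : Over k A → Over k B → Over k (A ∧f B)
over-∧ a b = over-¬ (a ⇒ over-¬ b)

over-⊡Fix : Over k x → Over k (⊡ Fix x)
over-⊡Fix {k} {x} ox = over-∧ fix (□ fix)
  where
  fix : Over k (Fix x)
  fix = over-∧ (ox ⇒ over-¬ (I ox)) (over-¬ (I ox) ⇒ ox)

odd : ℕ → Bool
odd zero = false
odd (suc n) = not (odd n)

oddly : Valuation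
oddly p = odd

Fix-oddly : ∀ k n → sat oddly (Fix (var k)) n ≡ true
Fix-oddly k zero = refl
Fix-oddly k (suc n) with odd n
... | true = refl
... | false = refl

⊡Fix-oddly : ∀ k n → sat oddly (⊡ Fix (var k)) n ≡ true
⊡Fix-oddly k n rewrite Fix-oddly k n | allBelow-all _ n (Fix-oddly k) = refl

Aᶜ Bᶜ : Fm
Aᶜ = ⊡ Fix (var 0) ∧f var 0
Bᶜ = ⊡ Fix (var 1) ⇒ var 1

sat-Aᶜ : ∀ n → sat oddly Aᶜ n ≡ odd n
sat-Aᶜ n rewrite ⊡Fix-oddly 0 n with odd n
... | true = refl
... | false = refl

sat-Bᶜ : ∀ n → sat oddly Bᶜ n ≡ odd n
sat-Bᶜ n rewrite ⊡Fix-oddly 1 n = refl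

over-Aᶜ : Over 0 Aᶜ
over-Aᶜ = over-∧ (over-⊡Fix var) var

over-Bᶜ : Over 1 Bᶜ
over-Bᶜ = over-⊡Fix var ⇒ var

StableFrom-resp : ∀ {N f g} → f ≗ g → StableFrom N f → StableFrom N g
StableFrom-resp {f = f} {g} f≗g stable {m} N≤m = begin
  g (suc m)   ≡⟨ sym (f≗g (suc m)) ⟩
  f (suc m)   ≡⟨ stable N≤m ⟩
  f m         ≡⟨ f≗g m ⟩
  g m         ∎
  where open ≡-Reasoning

odd-unstable : ∀ N → ¬ StableFrom N odd
odd-unstable N stable = not-¬ refl (sym (stable ≤-refl))

no-interpolant : S ⊆ Valid → ¬ (Σ Fm λ C → Interpolant S Aᶜ Bᶜ C)
no-interpolant valid (C , common , A⇒C , C⇒B) =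
  let N , stable = closed-eventually-stable oddly C closed in
  odd-unstable N (StableFrom-resp C-odd stable)
  where
  closed : Closed C
  closed p o = let inA , inB = common p o in
    0≢1+n (trans (sym (over-occurs over-Aᶜ inA)) (over-occurs over-Bᶜ inB))
  C-odd : ∀ n → sat oddly C n ≡ odd n
  C-odd n = ⇔→≡ (mk⇔ (λ c → trans (sym (sat-Bᶜ n)) (⇒ᵇ-elim (soundness valid C⇒B oddly n) c))
                     (λ o → ⇒ᵇ-elim (soundness valid A⇒C oddly n) (trans (sat-Aᶜ n) o)))

no-CIP : I2 ⊆ S → S ⊆ Valid → NoCIP S
no-CIP i2 valid = Aᶜ , Bᶜ , Fix-unique i2 (var 0) (var 1) , no-interpolant valid

corollary5p10 : NoCIP il-I2 × NoCIP il-J1u-I2 × NoCIP il-J15u-I2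
corollary5p10 =
  no-CIP (λ i → i) I2-valid ,
  no-CIP (false ,_) (∪-⊆ J1u-valid I2-valid) ,
  no-CIP (false ,_) (∪-⊆ J15u-valid I2-valid)
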